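{- For $n\ge 1$, $$A_{n+1}(x;q)=qA_n(x;q)+qx\sum_{k=0}^{n-1}\binom{n}{k}A_k(x;q)A_{n-k}(x).$$
   Context: $\mathfrak{S}_n$ is the symmetric group on $[n]=\{1,\dots,n\}$. For $\pi\in\mathfrak{S}_n$, $\mathrm{exc}(\pi)=\#\{i\in[n]:\pi(i)>i\}$ and $\mathrm{cyc}(\pi)$ is the number of cycles of $\pi$. The $q$-Eulerian polynomials are $A_n(x;q)=\sum_{\pi\in\mathfrak{S}_n}x^{\mathrm{exc}(\pi)}q^{\mathrm{cyc}(\pi)}$ (so $A_0(x;q)=1$), and the Eulerian polynomials are $A_0(x)=1$, $A_n(x)=\sum_{\pi\in\mathfrak{S}_n}x^{\mathrm{exc}(\pi)}$ for $n\ge1$. -}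

module Defs where

open import Level using (Level)
open import Data.Nat as ℕ using (ℕ; zero; suc)
open import Data.Nat.Combinatorics using (_C_)
open import Data.Fin as Fin using (Fin; toℕ)
open import Data.Fin.Properties as FinP using ()
open import Data.Vec as Vec using (Vec; []; _∷_; lookup)
open import Data.List as List using (List; []; _∷_; map; concatMap; filter; length; foldr; upTo; allFin)
open import Data.List.Relation.Unary.All using (all?)
open import Data.Bool using (Bool; true; false; _∧_)
open import Relation.Nullary.Decidable using (does; Dec; yes; no; _×-dec_; _→-dec_)
open import Relation.Binary.PropositionalEquality using (_≡_)
open import Algebra.Bundles using (CommutativeSemiring)

-- A permutation of [n] = {0,…,n-1} (Fin n) is represented by the vector of
-- its values: σ i = lookup v i.

allVecs : (n m : ℕ) → List (Vec (Fin m) n)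
allVecs zero    m = [] ∷ []
allVecs (suc n) m = concatMap (λ a → map (a ∷_) (allVecs n m)) (allFin m)

Injective : ∀ {n} → Vec (Fin n) n → Set
Injective {n} v = ∀ (i j : Fin n) → lookup v i ≡ lookup v j → i ≡ j

injective? : ∀ {n} (v : Vec (Fin n) n) → Dec (Injective v)
injective? {n} v =
  FinP.all? λ i → FinP.all? λ j → (lookup v i Fin.≟ lookup v j) →-dec (i Fin.≟ j)

perms : (n : ℕ) → List (Vec (Fin n) n)
perms n = filter injective? (allVecs n n)

count : ∀ {n} → (Fin n → Bool) → ℕ
count {n} p = length (filter (λ i → p i Data.Bool.≟ true) (allFin n))

exc : ∀ {n} → Vec (Fin n) n → ℕ
exc v = count (λ i → does (toℕ i ℕ.<? toℕ (lookup v i)))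

iter : ∀ {n} → Vec (Fin n) n → ℕ → Fin n → Fin n
iter v zero    i = i
iter v (suc k) i = lookup v (iter v k i)

-- i is the minimum of its cycle: σ^k(i) ≥ i for all k < n
-- (the cycle of i is { σ^k(i) : k < n })
isCycleMin : ∀ {n} → Vec (Fin n) n → Fin n → Bool
isCycleMin {n} v i =
  does (all? (λ k → toℕ i ℕ.≤? toℕ (iter v k i)) (upTo n))

-- cyc(σ) = number of cycles = number of cycle minima
cyc : ∀ {n} → Vec (Fin n) n → ℕ
cyc v = count (isCycleMin v)

module Eulerian {c ℓ : Level} (R : CommutativeSemiring c ℓ) where
  open CommutativeSemiring R
  open import Algebra.Definitions.RawSemiring rawSemiring using (_^_; _×_) public

  Σₗ : List Carrier → Carrier
  Σₗ = foldr _+_ 0#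

  -- q-Eulerian polynomial A_n(x;q) evaluated at x, q ∈ R
  -- (A_0(x;q) = 1 automatically: 𝔖_0 has one element, with exc = cyc = 0)
  Aq : ℕ → Carrier → Carrier → Carrier
  Aq n x q = Σₗ (map (λ σ → (x ^ exc σ) * (q ^ cyc σ)) (perms n))

  A : ℕ → Carrier → Carrier
  A n x = Σₗ (map (λ σ → x ^ exc σ) (perms n))

module Submission where

-- For a weight w : ℕ → ℕ → R write  permSum n w = Σ_{σ ∈ 𝔖_n} w (exc σ) (cyc σ),
-- so that A_n(x;q) = permSum n (λ j c → x^j q^c).
--
-- Every σ ∈ 𝔖_{n+1} arises
--    exactly once from a pair (π, o), π ∈ 𝔖_n, o ∈ {none} ∪ [n]: for o = none
--    the new maximum n is adjoined as a fixed point (exc unchanged, one more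
--    cycle), for o = a it is inserted into the cycle of π right after a (one
--    more excedance unless a already was one, same number of cycles).
-- 2. The Eulerian recurrence (module WeightedSums).  Summing over these pairs
--    gives, for every weight w,
--      permSum (n+1) w = permSum n (stepWeight n w),
--      stepWeight n w j c = w j (c+1) + j·w j c + (n-j)·w (j+1) c.
-- 3. A binomial convolution identity, derived from this recurrence alone by
--    induction on n: permSum (n+1) w is the shift of permSum n in the cycle
--    variable plus Σ_k C(n,k) Σ_{σ∈𝔖_k} Σ_{τ∈𝔖_{n-k}} w (1+exc σ+exc τ) (1+cyc σ).
-- 4. Specialising to w j c = x^j q^c gives the theorem.

open import Defs
open import Level using (Level)
open import Data.Nat using (ℕ; suc; _≤_; _∸_)
open import Data.Nat.Combinatorics using (_C_)
open import Data.List using (map; upTo)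
open import Algebra.Bundles using (CommutativeSemiring)

module PermutationStatistics where

  open import Data.Nat as ℕ using (zero; _+_; _*_; _<_; z≤n; s≤s)
  import Data.Nat.Properties as ℕP
  open import Data.Nat.DivMod using (_%_; _/_; m≡m%n+[m/n]*n; m%n<n)
  open import Data.Bool as Bool using (Bool; true; false; not)
  open import Data.Maybe using (Maybe; just; nothing)
  open import Data.Maybe.Properties using (just-injective)
  open import Data.Product using (_×_; _,_; proj₁; proj₂; ∃)
  open import Data.Empty using (⊥-elim)
  open import Data.Fin as Fin using (Fin; toℕ; inject₁; fromℕ)
  import Data.Fin.Properties as FinP
  open import Data.Fin.Permutation.Components using (transpose; transpose-inverse)
  open import Data.Vec as Vec using (Vec; []; _∷_; lookup)
  import Data.Vec.Properties as VecP
  open import Data.List as List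
    using (List; []; _∷_; _++_; filter; length; tabulate; allFin; concatMap; cartesianProductWith)
  open import Data.List.Membership.Propositional using (_∈_)
  open import Data.List.Membership.Propositional.Properties
    using (∈-filter⁺; ∈-filter⁻; ∈-allFin; ∈-map⁺; ∈-map⁻; ∈-cartesianProductWith⁺; ∈-cartesianProductWith⁻; ∈-upTo⁺)
  open import Data.List.Membership.Propositional.Properties.WithK using (unique∧set⇒bag)
  open import Data.List.Relation.Binary.BagAndSetEquality using (∼bag⇒↭)
  open import Data.List.Relation.Binary.Permutation.Propositional using (_↭_)
  open import Data.List.Relation.Unary.Any using (here; there)
  open import Data.List.Relation.Unary.All as All using (all?)
  import Data.List.Relation.Unary.AllPairs as AllPairs
  open import Data.List.Relation.Unary.Unique.Propositional using (Unique)
  import Data.List.Relation.Unary.Unique.Propositional.Properties as Unique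
  open import Function using (_∘_)
  open import Function.Bundles using (_⇔_; mk⇔; Equivalence)
  open import Relation.Nullary using (¬_)
  open import Relation.Nullary.Decidable using (does; yes; no; dec-true; dec-false; does-⇔)
  open import Relation.Binary.PropositionalEquality

  private variable m n : ℕ

  -- Counting the true values of a boolean predicate on Fin n.  `count` from
  -- Defs filters a list; the recursive form #true is easier to reason about.

  ⟦_⟧ : Bool → ℕ
  ⟦ true ⟧  = 1
  ⟦ false ⟧ = 0

  #true : (Fin n → Bool) → ℕ
  #true {zero}  p = 0
  #true {suc n} p = ⟦ p Fin.zero ⟧ + #true (p ∘ Fin.suc)

  count-tabulate : ∀ {A : Set} (q : A → Bool) (f : Fin n → A) →
    length (filter (λ a → q a Bool.≟ true) (tabulate f)) ≡ #true (q ∘ f)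
  count-tabulate {zero}  q f = refl
  count-tabulate {suc n} q f with q (f Fin.zero)
  ... | true  = cong suc (count-tabulate q (f ∘ Fin.suc))
  ... | false = count-tabulate q (f ∘ Fin.suc)

  count≡#true : (p : Fin n → Bool) → count p ≡ #true p
  count≡#true p = count-tabulate p (λ i → i)

  #true-cong : {p q : Fin n → Bool} → (∀ i → p i ≡ q i) → #true p ≡ #true q
  #true-cong {zero}  e = refl
  #true-cong {suc n} e = cong₂ _+_ (cong ⟦_⟧ (e Fin.zero)) (#true-cong (e ∘ Fin.suc))

  #true≤ : (p : Fin n → Bool) → #true p ≤ n
  #true≤ {zero}  p = z≤n
  #true≤ {suc n} p with p Fin.zero
  ... | true  = s≤s (#true≤ (p ∘ Fin.suc))
  ... | false = ℕP.m≤n⇒m≤1+n (#true≤ (p ∘ Fin.suc))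

  #true-last : (p : Fin (suc n) → Bool) → #true p ≡ #true (p ∘ inject₁) + ⟦ p (fromℕ n) ⟧
  #true-last {zero}  p = ℕP.+-comm ⟦ p Fin.zero ⟧ 0
  #true-last {suc n} p =
    trans (cong (⟦ p Fin.zero ⟧ +_) (#true-last (p ∘ Fin.suc))) (sym (ℕP.+-assoc ⟦ p Fin.zero ⟧ _ _))

  #true-setTrue : (p q : Fin n → Bool) (a : Fin n) → q a ≡ true → (∀ j → ¬ j ≡ a → q j ≡ p j) →
    #true q ≡ #true p + ⟦ not (p a) ⟧
  #true-setTrue {suc n} p q Fin.zero qa rest
    rewrite qa | #true-cong {p = q ∘ Fin.suc} {p ∘ Fin.suc} (λ j → rest (Fin.suc j) λ ())
    with p Fin.zero
  ... | true  = cong suc (sym (ℕP.+-identityʳ _))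
  ... | false = ℕP.+-comm 1 _
  #true-setTrue {suc n} p q (Fin.suc a) qa rest
    rewrite rest Fin.zero (λ ())
          | #true-setTrue (p ∘ Fin.suc) (q ∘ Fin.suc) a qa (λ j j≢a → rest (Fin.suc j) (j≢a ∘ FinP.suc-injective))
    = sym (ℕP.+-assoc ⟦ p Fin.zero ⟧ _ _)

  allVecs≡cartesianProduct : ∀ n m → allVecs (suc n) m ≡ cartesianProductWith _∷_ (allFin m) (allVecs n m)
  allVecs≡cartesianProduct n m = concatMap≡ (allFin m)
    where
    concatMap≡ : (xs : List (Fin m)) →
      concatMap (λ a → map (a ∷_) (allVecs n m)) xs ≡ cartesianProductWith _∷_ xs (allVecs n m)
    concatMap≡ []       = refl
    concatMap≡ (x ∷ xs) = cong (map (x ∷_) (allVecs n m) ++_) (concatMap≡ xs)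

  allVecs-unique : ∀ n m → Unique (allVecs n m)
  allVecs-unique zero    m = AllPairs._∷_ All.[] AllPairs.[]
  allVecs-unique (suc n) m rewrite allVecs≡cartesianProduct n m =
    Unique.cartesianProductWith⁺ _∷_ ∷-injective (Unique.allFin⁺ m) (allVecs-unique n m)
    where
    ∷-injective : ∀ {a b : Fin m} {u v : Vec (Fin m) n} → a ∷ u ≡ b ∷ v → a ≡ b × u ≡ v
    ∷-injective refl = refl , refl

  allVecs-complete : ∀ {n m} (v : Vec (Fin m) n) → v ∈ allVecs n m
  allVecs-complete []      = here refl
  allVecs-complete {suc n} {m} (a ∷ v) rewrite allVecs≡cartesianProduct n m =
    ∈-cartesianProductWith⁺ _∷_ (∈-allFin a) (allVecs-complete v)

  perms-unique : ∀ n → Unique (perms n)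
  perms-unique n = Unique.filter⁺ injective? (allVecs-unique n n)

  perms⁺ : (v : Vec (Fin n) n) → Injective v → v ∈ perms n
  perms⁺ v inj = ∈-filter⁺ injective? (allVecs-complete v) inj

  perms⁻ : {v : Vec (Fin n) n} → v ∈ perms n → Injective v
  perms⁻ {n} v∈ = proj₂ (∈-filter⁻ injective? {xs = allVecs n n} v∈)

  -- Iterates of an injective self-map of Fin m: every point is periodic with
  -- a period at most m.  This yields surjectivity here and, later, lets the
  -- bounded test isCycleMin speak about the whole orbit.

  iter-+ : (v : Vec (Fin m) m) (a b : ℕ) (i : Fin m) → iter v (a + b) i ≡ iter v a (iter v b i)
  iter-+ v zero    b i = refl
  iter-+ v (suc a) b i = cong (lookup v) (iter-+ v a b i)

  iter-injective : (v : Vec (Fin m) m) → Injective v → ∀ s {i j} → iter v s i ≡ iter v s j → i ≡ j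
  iter-injective v inj zero    e = e
  iter-injective v inj (suc s) e = iter-injective v inj s (inj _ _ e)

  iter-period : (v : Vec (Fin m) m) → Injective v → ∀ i → ∃ λ d → suc d ≤ m × iter v (suc d) i ≡ i
  iter-period {m} v inj i with FinP.pigeonhole (ℕP.n<1+n m) (λ t → iter v (toℕ t) i)
  ... | t₁ , t₂ , t₁<t₂ , same with ℕP.m≤n⇒∃[o]m+o≡n t₁<t₂
  ...   | d , t₁+1+d≡t₂ = d , bound , iter-injective v inj (toℕ t₁) returns
    where
    t₂≡t₁+[1+d] : toℕ t₂ ≡ toℕ t₁ + suc d
    t₂≡t₁+[1+d] = trans (sym t₁+1+d≡t₂) (sym (ℕP.+-suc (toℕ t₁) d))
    bound : suc d ≤ m
    bound = ℕP.≤-trans (ℕP.m≤n+m (suc d) (toℕ t₁))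
              (ℕP.≤-trans (ℕP.≤-reflexive (sym t₂≡t₁+[1+d])) (ℕP.≤-pred (FinP.toℕ<n t₂)))
    returns : iter v (toℕ t₁) (iter v (suc d) i) ≡ iter v (toℕ t₁) i
    returns = begin
      iter v (toℕ t₁) (iter v (suc d) i) ≡⟨ sym (iter-+ v (toℕ t₁) (suc d) i) ⟩
      iter v (toℕ t₁ + suc d) i           ≡⟨ cong (λ t → iter v t i) (sym t₂≡t₁+[1+d]) ⟩
      iter v (toℕ t₂) i                   ≡⟨ sym same ⟩
      iter v (toℕ t₁) i                   ∎
      where open ≡-Reasoning

  preimage : (v : Vec (Fin m) m) → Injective v → ∀ i → ∃ λ j → lookup v j ≡ i
  preimage v inj i with iter-period v inj i
  ... | d , _ , returns = iter v d i , returns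

  data View : Fin (suc n) → Set where
    old : (j : Fin n) → View (inject₁ j)
    new : View (fromℕ n)

  view : (i : Fin (suc n)) → View i
  view {zero}  Fin.zero    = new
  view {suc n} Fin.zero    = old Fin.zero
  view {suc n} (Fin.suc i) with view i
  ... | old j = old (Fin.suc j)
  ... | new   = new

  view-old : (j : Fin n) → view (inject₁ j) ≡ old j
  view-old {suc n} Fin.zero    = refl
  view-old {suc n} (Fin.suc j) rewrite view-old j = refl

  view-new : ∀ n → view (fromℕ n) ≡ new
  view-new zero    = refl
  view-new (suc n) rewrite view-new n = refl

  old≢new : (j : Fin n) → ¬ inject₁ j ≡ fromℕ n
  old≢new j e = FinP.fromℕ≢inject₁ (sym e)

  Injectiveᶠ : (Fin m → Fin m) → Set
  Injectiveᶠ {m} f = ∀ (i j : Fin m) → f i ≡ f j → i ≡ j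

  extendMax : Vec (Fin n) n → Fin (suc n) → Fin (suc n)
  extendMax π i = extendAt (view i)
    where
    extendAt : ∀ {i} → View i → Fin (suc _)
    extendAt (old j) = inject₁ (lookup π j)
    extendAt new     = fromℕ _

  extendMax-old : (π : Vec (Fin n) n) (j : Fin n) → extendMax π (inject₁ j) ≡ inject₁ (lookup π j)
  extendMax-old π j rewrite view-old j = refl

  extendMax-new : (π : Vec (Fin n) n) → extendMax π (fromℕ n) ≡ fromℕ n
  extendMax-new {n} π rewrite view-new n = refl

  extendMax-injective : {π : Vec (Fin n) n} → Injective π → Injectiveᶠ (extendMax π)
  extendMax-injective {π = π} inj i₁ i₂ = cases (view i₁) (view i₂)
    where
    cases : ∀ {i₁ i₂} → View i₁ → View i₂ → extendMax π i₁ ≡ extendMax π i₂ → i₁ ≡ i₂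
    cases (old j₁) (old j₂) e = cong inject₁ (inj j₁ j₂ (FinP.inject₁-injective
      (trans (sym (extendMax-old π j₁)) (trans e (extendMax-old π j₂)))))
    cases (old j₁) new e = ⊥-elim (old≢new _ (trans (sym (extendMax-old π j₁)) (trans e (extendMax-new π))))
    cases new (old j₂) e = ⊥-elim (old≢new _ (trans (sym (extendMax-old π j₂)) (trans (sym e) (extendMax-new π))))
    cases new new e = refl

  lowerOr : Fin (suc n) → Fin n → Fin n
  lowerOr i d = lowerAt (view i)
    where
    lowerAt : ∀ {i} → View i → Fin _
    lowerAt (old j) = j
    lowerAt new     = d

  lowerOr-old : (j d : Fin n) → lowerOr (inject₁ j) d ≡ j
  lowerOr-old j d rewrite view-old j = refl

  inject₁-lowerOr : (i : Fin (suc n)) (d : Fin n) → ¬ i ≡ fromℕ n → inject₁ (lowerOr i d) ≡ i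
  inject₁-lowerOr i d i≢n = cases (view i) i≢n
    where
    cases : ∀ {i} → View i → ¬ i ≡ fromℕ _ → inject₁ (lowerOr i d) ≡ i
    cases (old j) _   = cong inject₁ (lowerOr-old j d)
    cases new     n≢n = ⊥-elim (n≢n refl)

  -- The restriction to Fin n of a map g of Fin (suc n); meaningful when g
  -- fixes the maximum, and then the inverse of extendMax.
  restrictMax : (Fin (suc n) → Fin (suc n)) → Vec (Fin n) n
  restrictMax g = Vec.tabulate λ j → lowerOr (g (inject₁ j)) j

  restrictMax-extendMax : (π : Vec (Fin n) n) → restrictMax (extendMax π) ≡ π
  restrictMax-extendMax π =
    trans (VecP.tabulate-cong λ j → trans (cong (λ i → lowerOr i j) (extendMax-old π j)) (lowerOr-old _ j))
          (VecP.tabulate∘lookup π)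

  module _ {g : Fin (suc n) → Fin (suc n)} (inj : Injectiveᶠ g) (fixes : g (fromℕ n) ≡ fromℕ n) where

    restrictMax-old : ∀ j → inject₁ (lookup (restrictMax g) j) ≡ g (inject₁ j)
    restrictMax-old j =
      trans (cong inject₁ (VecP.lookup∘tabulate _ j))
            (inject₁-lowerOr (g (inject₁ j)) j λ e → old≢new j (inj _ _ (trans e (sym fixes))))

    restrictMax-injective : Injective (restrictMax g)
    restrictMax-injective j₁ j₂ e = FinP.inject₁-injective
      (inj _ _ (trans (sym (restrictMax-old j₁)) (trans (cong inject₁ e) (restrictMax-old j₂))))

    extendMax-restrictMax : ∀ i → extendMax (restrictMax g) i ≡ g i
    extendMax-restrictMax i = cases (view i)
      where
      cases : ∀ {i} → View i → extendMax (restrictMax g) i ≡ g i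
      cases (old j) = trans (extendMax-old _ j) (restrictMax-old j)
      cases new     = trans (extendMax-new _) (sym fixes)

  transpose-at₁ : (i j : Fin m) → transpose i j i ≡ j
  transpose-at₁ i j rewrite dec-true (i Fin.≟ i) refl = refl

  transpose-at₂ : (i j : Fin m) → ¬ j ≡ i → transpose i j j ≡ i
  transpose-at₂ i j j≢i rewrite dec-false (j Fin.≟ i) j≢i | dec-true (j Fin.≟ j) refl = refl

  transpose-elsewhere : (i j k : Fin m) → ¬ k ≡ i → ¬ k ≡ j → transpose i j k ≡ k
  transpose-elsewhere i j k k≢i k≢j rewrite dec-false (k Fin.≟ i) k≢i | dec-false (k Fin.≟ j) k≢j = refl

  swapMax : Maybe (Fin n) → Fin (suc n) → Fin (suc n)
  swapMax nothing  i = i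
  swapMax (just a) i = transpose (inject₁ a) (fromℕ _) i

  unswapMax : Maybe (Fin n) → Fin (suc n) → Fin (suc n)
  unswapMax nothing  i = i
  unswapMax (just a) i = transpose (fromℕ _) (inject₁ a) i

  swap-unswap : (o : Maybe (Fin n)) (i : Fin (suc n)) → swapMax o (unswapMax o i) ≡ i
  swap-unswap nothing  i = refl
  swap-unswap (just a) i = transpose-inverse (inject₁ a) (fromℕ _)

  unswap-swap : (o : Maybe (Fin n)) (i : Fin (suc n)) → unswapMax o (swapMax o i) ≡ i
  unswap-swap nothing  i = refl
  unswap-swap (just a) i = transpose-inverse (fromℕ _) (inject₁ a)

  -- The permutation of Fin (suc n) obtained from π by adjoining the new
  -- maximum n: as a fixed point (nothing), or right after a in the cycle of
  -- a (just a).
  adjoin : Vec (Fin n) n → Maybe (Fin n) → Vec (Fin (suc n)) (suc n)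
  adjoin π o = Vec.tabulate (extendMax π ∘ swapMax o)

  lookup-adjoin : (π : Vec (Fin n) n) (o : Maybe (Fin n)) (i : Fin (suc n)) →
    lookup (adjoin π o) i ≡ extendMax π (swapMax o i)
  lookup-adjoin π o = VecP.lookup∘tabulate (extendMax π ∘ swapMax o)

  module _ (π : Vec (Fin n) n) where

    fixed-old : (j : Fin n) → lookup (adjoin π nothing) (inject₁ j) ≡ inject₁ (lookup π j)
    fixed-old j = trans (lookup-adjoin π nothing _) (extendMax-old π j)

    fixed-new : lookup (adjoin π nothing) (fromℕ n) ≡ fromℕ n
    fixed-new = trans (lookup-adjoin π nothing _) (extendMax-new π)

    inserted-after : (a : Fin n) → lookup (adjoin π (just a)) (inject₁ a) ≡ fromℕ n
    inserted-after a = trans (lookup-adjoin π (just a) (inject₁ a))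
      (trans (cong (extendMax π) (transpose-at₁ (inject₁ a) (fromℕ n))) (extendMax-new π))

    inserted-new : (a : Fin n) → lookup (adjoin π (just a)) (fromℕ n) ≡ inject₁ (lookup π a)
    inserted-new a = trans (lookup-adjoin π (just a) (fromℕ n))
      (trans (cong (extendMax π) (transpose-at₂ (inject₁ a) (fromℕ n) (old≢new a ∘ sym))) (extendMax-old π a))

    inserted-old : (a j : Fin n) → ¬ j ≡ a → lookup (adjoin π (just a)) (inject₁ j) ≡ inject₁ (lookup π j)
    inserted-old a j j≢a = trans (lookup-adjoin π (just a) (inject₁ j))
      (trans (cong (extendMax π) (transpose-elsewhere (inject₁ a) (fromℕ n) (inject₁ j) (j≢a ∘ FinP.inject₁-injective) (old≢new j)))
             (extendMax-old π j))

  adjoin-injective : {π : Vec (Fin n) n} → Injective π → ∀ o → Injective (adjoin π o)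
  adjoin-injective {π = π} inj o i j e =
    trans (sym (unswap-swap o i))
      (trans (cong (unswapMax o) (extendMax-injective inj _ _
                (trans (sym (lookup-adjoin π o i)) (trans e (lookup-adjoin π o j)))))
             (unswap-swap o j))

  maxPreimage : Vec (Fin (suc n)) (suc n) → Maybe (Fin n)
  maxPreimage {n} σ with FinP.any? (λ a → lookup σ (inject₁ a) Fin.≟ fromℕ n)
  ... | yes (a , _) = just a
  ... | no _        = nothing

  maxPreimage-adjoin : (π : Vec (Fin n) n) (o : Maybe (Fin n)) → maxPreimage (adjoin π o) ≡ o
  maxPreimage-adjoin {n} π nothing with FinP.any? (λ a → lookup (adjoin π nothing) (inject₁ a) Fin.≟ fromℕ n)
  ... | yes (a , e) = ⊥-elim (old≢new _ (trans (sym (fixed-old π a)) e))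
  ... | no _        = refl
  maxPreimage-adjoin {n} π (just a) with FinP.any? (λ b → lookup (adjoin π (just a)) (inject₁ b) Fin.≟ fromℕ n)
  ... | no none     = ⊥-elim (none (a , inserted-after π a))
  ... | yes (b , e) with b Fin.≟ a
  ...   | yes refl = refl
  ...   | no b≢a   = ⊥-elim (old≢new _ (trans (sym (inserted-old π a b b≢a)) e))

  unswap-fixes : (σ : Vec (Fin (suc n)) (suc n)) → Injective σ →
    lookup σ (unswapMax (maxPreimage σ) (fromℕ n)) ≡ fromℕ n
  unswap-fixes {n} σ inj with FinP.any? (λ a → lookup σ (inject₁ a) Fin.≟ fromℕ n)
  ... | yes (a , e) = trans (cong (lookup σ) (transpose-at₁ (fromℕ n) (inject₁ a))) e
  ... | no none     = cases (view (proj₁ (preimage σ inj (fromℕ n)))) (proj₂ (preimage σ inj (fromℕ n)))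
    where
    cases : ∀ {p} → View p → lookup σ p ≡ fromℕ n → lookup σ (fromℕ n) ≡ fromℕ n
    cases (old a) e = ⊥-elim (none (a , e))
    cases new     e = e

  remove : Vec (Fin (suc n)) (suc n) → Vec (Fin n) n
  remove σ = restrictMax (lookup σ ∘ unswapMax (maxPreimage σ))

  remove-adjoin : (π : Vec (Fin n) n) (o : Maybe (Fin n)) → remove (adjoin π o) ≡ π
  remove-adjoin π o = trans (VecP.tabulate-cong λ j → cong (λ i → lowerOr i j) (undo (inject₁ j)))
                            (restrictMax-extendMax π)
    where
    undo : ∀ i → lookup (adjoin π o) (unswapMax (maxPreimage (adjoin π o)) i) ≡ extendMax π i
    undo i = trans (cong (λ o′ → lookup (adjoin π o) (unswapMax o′ i)) (maxPreimage-adjoin π o))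
                   (trans (lookup-adjoin π o _) (cong (extendMax π) (swap-unswap o i)))

  module _ (σ : Vec (Fin (suc n)) (suc n)) (inj : Injective σ) where

    private
      o : Maybe (Fin n)
      o = maxPreimage σ
      undone-injective : Injectiveᶠ (lookup σ ∘ unswapMax o)
      undone-injective i j e = trans (sym (swap-unswap o i)) (trans (cong (swapMax o) (inj _ _ e)) (swap-unswap o j))

    remove-injective : Injective (remove σ)
    remove-injective = restrictMax-injective undone-injective (unswap-fixes σ inj)

    adjoin-remove : adjoin (remove σ) (maxPreimage σ) ≡ σ
    adjoin-remove = trans (VecP.tabulate-cong λ i →
        trans (extendMax-restrictMax undone-injective (unswap-fixes σ inj) (swapMax o i))
              (cong (lookup σ) (unswap-swap o i)))
      (VecP.tabulate∘lookup σ)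

  positions : ∀ n → List (Maybe (Fin n))
  positions n = nothing ∷ map just (allFin n)

  positions-unique : ∀ n → Unique (positions n)
  positions-unique n = AllPairs._∷_ (All.tabulate λ o∈ e → nothing∉ o∈ (sym e))
                                    (Unique.map⁺ just-injective (Unique.allFin⁺ n))
    where
    nothing∉ : ∀ {o} → o ∈ map just (allFin n) → ¬ o ≡ nothing
    nothing∉ o∈ refl with ∈-map⁻ just o∈
    ... | _ , _ , ()

  positions-complete : (o : Maybe (Fin n)) → o ∈ positions n
  positions-complete nothing  = here refl
  positions-complete (just a) = there (∈-map⁺ just (∈-allFin a))

  adjoin-pair-injective : ∀ {π π′ : Vec (Fin n) n} {o o′} → adjoin π o ≡ adjoin π′ o′ → π ≡ π′ × o ≡ o′
  adjoin-pair-injective {π = π} {π′} {o} {o′} e =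
    trans (sym (remove-adjoin π o)) (trans (cong remove e) (remove-adjoin π′ o′)) ,
    trans (sym (maxPreimage-adjoin π o)) (trans (cong maxPreimage e) (maxPreimage-adjoin π′ o′))

  perms-suc↭ : ∀ n → perms (suc n) ↭ cartesianProductWith adjoin (perms n) (positions n)
  perms-suc↭ n = ∼bag⇒↭ (unique∧set⇒bag (perms-unique (suc n))
    (Unique.cartesianProductWith⁺ adjoin adjoin-pair-injective (perms-unique n) (positions-unique n))
    (mk⇔ to from))
    where
    to : ∀ {σ} → σ ∈ perms (suc n) → σ ∈ cartesianProductWith adjoin (perms n) (positions n)
    to {σ} σ∈ = subst (_∈ _) (adjoin-remove σ (perms⁻ σ∈))
      (∈-cartesianProductWith⁺ adjoin (perms⁺ (remove σ) (remove-injective σ (perms⁻ σ∈))) (positions-complete (maxPreimage σ)))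
    from : ∀ {σ} → σ ∈ cartesianProductWith adjoin (perms n) (positions n) → σ ∈ perms (suc n)
    from σ∈ with ∈-cartesianProductWith⁻ adjoin (perms n) (positions n) σ∈
    ... | π , o , π∈ , _ , refl = perms⁺ _ (adjoin-injective (perms⁻ π∈) o)

  isExc : Vec (Fin n) n → Fin n → Bool
  isExc v i = does (toℕ i ℕ.<? toℕ (lookup v i))

  isExc-new : (σ : Vec (Fin (suc n)) (suc n)) → isExc σ (fromℕ n) ≡ false
  isExc-new {n} σ = dec-false (toℕ (fromℕ n) ℕ.<? toℕ (lookup σ (fromℕ n)))
    (ℕP.≤⇒≯ (subst (toℕ (lookup σ (fromℕ n)) ≤_) (sym (FinP.toℕ-fromℕ n)) (ℕP.≤-pred (FinP.toℕ<n _))))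

  isExc-old : (σ : Vec (Fin (suc n)) (suc n)) (π : Vec (Fin n) n) (j : Fin n) →
    lookup σ (inject₁ j) ≡ inject₁ (lookup π j) → isExc σ (inject₁ j) ≡ isExc π j
  isExc-old σ π j e rewrite e | FinP.toℕ-inject₁ j | FinP.toℕ-inject₁ (lookup π j) = refl

  isExc-toNew : (σ : Vec (Fin (suc n)) (suc n)) (j : Fin n) → lookup σ (inject₁ j) ≡ fromℕ n → isExc σ (inject₁ j) ≡ true
  isExc-toNew {n} σ j e = dec-true (toℕ (inject₁ j) ℕ.<? toℕ (lookup σ (inject₁ j)))
    (subst (λ x → toℕ (inject₁ j) < toℕ x) (sym e) (subst (toℕ (inject₁ j) <_) (sym (FinP.toℕ-fromℕ n)) (FinP.inject₁ℕ< j)))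

  exc-old : (σ : Vec (Fin (suc n)) (suc n)) → exc σ ≡ #true (isExc σ ∘ inject₁)
  exc-old {n} σ = trans (count≡#true (isExc σ))
    (trans (#true-last (isExc σ)) (trans (cong (λ b → #true (isExc σ ∘ inject₁) + ⟦ b ⟧) (isExc-new σ)) (ℕP.+-identityʳ _)))

  exc-fixed : (π : Vec (Fin n) n) → exc (adjoin π nothing) ≡ exc π
  exc-fixed π = begin
    exc (adjoin π nothing)                     ≡⟨ exc-old (adjoin π nothing) ⟩
    #true (isExc (adjoin π nothing) ∘ inject₁) ≡⟨ #true-cong (λ j → isExc-old (adjoin π nothing) π j (fixed-old π j)) ⟩
    #true (isExc π)                            ≡⟨ sym (count≡#true (isExc π)) ⟩
    exc π                                      ∎
    where open ≡-Reasoning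

  exc-inserted : (π : Vec (Fin n) n) (a : Fin n) → exc (adjoin π (just a)) ≡ exc π + ⟦ not (isExc π a) ⟧
  exc-inserted π a = begin
    exc (adjoin π (just a))                     ≡⟨ exc-old (adjoin π (just a)) ⟩
    #true (isExc (adjoin π (just a)) ∘ inject₁) ≡⟨ #true-setTrue (isExc π) _ a (isExc-toNew (adjoin π (just a)) a (inserted-after π a))
                                                     (λ j j≢a → isExc-old (adjoin π (just a)) π j (inserted-old π a j j≢a)) ⟩
    #true (isExc π) + ⟦ not (isExc π a) ⟧       ≡⟨ cong (_+ ⟦ not (isExc π a) ⟧) (sym (count≡#true (isExc π))) ⟩
    exc π + ⟦ not (isExc π a) ⟧                 ∎
    where open ≡-Reasoning

  exc≤ : (v : Vec (Fin n) n) → exc v ≤ n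
  exc≤ v = subst (_≤ _) (sym (count≡#true (isExc v))) (#true≤ (isExc v))

  MinOfOrbit : Vec (Fin m) m → Fin m → Set
  MinOfOrbit v i = ∀ k → toℕ i ≤ toℕ (iter v k i)

  BoundedMin : Vec (Fin m) m → Fin m → Set
  BoundedMin {m} v i = All.All (λ k → toℕ i ≤ toℕ (iter v k i)) (List.upTo m)

  iter-multiple : (v : Vec (Fin m) m) {p : ℕ} {i : Fin m} → iter v p i ≡ i → ∀ q → iter v (q * p) i ≡ i
  iter-multiple v         e zero    = refl
  iter-multiple v {p} {i} e (suc q) = trans (iter-+ v p (q * p) i) (trans (cong (iter v p) (iter-multiple v e q)) e)

  iter-mod : (v : Vec (Fin m) m) {d : ℕ} {i : Fin m} → iter v (suc d) i ≡ i → ∀ k → iter v k i ≡ iter v (k % suc d) i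
  iter-mod v {d} {i} e k = begin
    iter v k i                                   ≡⟨ cong (λ t → iter v t i) (m≡m%n+[m/n]*n k (suc d)) ⟩
    iter v (k % suc d + k / suc d * suc d) i     ≡⟨ iter-+ v (k % suc d) _ i ⟩
    iter v (k % suc d) (iter v (k / suc d * suc d) i) ≡⟨ cong (iter v (k % suc d)) (iter-multiple v e (k / suc d)) ⟩
    iter v (k % suc d) i                         ∎
    where open ≡-Reasoning

  boundedMin⇔minOfOrbit : (v : Vec (Fin m) m) → Injective v → (i : Fin m) → BoundedMin v i ⇔ MinOfOrbit v i
  boundedMin⇔minOfOrbit {m} v inj i = mk⇔ to (λ min → All.tabulate λ {k} _ → min k)
    where
    to : BoundedMin v i → MinOfOrbit v i
    to bounded k with iter-period v inj i
    ... | d , d<m , returns = subst (λ x → toℕ i ≤ toℕ x) (sym (iter-mod v returns k))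
      (All.lookup bounded (∈-upTo⁺ (ℕP.<-≤-trans (m%n<n k (suc d)) d<m)))

  module _ {v : Vec (Fin m) m} {i : Fin m} (inj : Injective v) where

    isCycleMin-true : MinOfOrbit v i → isCycleMin v i ≡ true
    isCycleMin-true min = dec-true (all? _ _) (Equivalence.from (boundedMin⇔minOfOrbit v inj i) min)

    isCycleMin-false : ¬ MinOfOrbit v i → isCycleMin v i ≡ false
    isCycleMin-false ¬min = dec-false (all? _ _) (¬min ∘ Equivalence.to (boundedMin⇔minOfOrbit v inj i))

    isCycleMin-≡ : ∀ {n} {v′ : Vec (Fin n) n} {i′ : Fin n} → Injective v′ →
      (MinOfOrbit v i → MinOfOrbit v′ i′) → (MinOfOrbit v′ i′ → MinOfOrbit v i) → isCycleMin v i ≡ isCycleMin v′ i′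
    isCycleMin-≡ {v′ = v′} {i′} inj′ to from = does-⇔ (mk⇔
      (Equivalence.from (boundedMin⇔minOfOrbit v′ inj′ i′) ∘ to ∘ Equivalence.to (boundedMin⇔minOfOrbit v inj i))
      (Equivalence.from (boundedMin⇔minOfOrbit v inj i) ∘ from ∘ Equivalence.to (boundedMin⇔minOfOrbit v′ inj′ i′)))
      (all? _ _) (all? _ _)

  cyc-split : (σ : Vec (Fin (suc n)) (suc n)) → cyc σ ≡ #true (isCycleMin σ ∘ inject₁) + ⟦ isCycleMin σ (fromℕ n) ⟧
  cyc-split σ = trans (count≡#true (isCycleMin σ)) (#true-last (isCycleMin σ))

  inject₁-≤⁺ : {x y : Fin n} → toℕ x ≤ toℕ y → toℕ (inject₁ x) ≤ toℕ (inject₁ y)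
  inject₁-≤⁺ {x = x} {y} = subst₂ _≤_ (sym (FinP.toℕ-inject₁ x)) (sym (FinP.toℕ-inject₁ y))

  inject₁-≤⁻ : {x y : Fin n} → toℕ (inject₁ x) ≤ toℕ (inject₁ y) → toℕ x ≤ toℕ y
  inject₁-≤⁻ {x = x} {y} = subst₂ _≤_ (FinP.toℕ-inject₁ x) (FinP.toℕ-inject₁ y)

  module _ (π : Vec (Fin n) n) (inj : Injective π) where

    private
      σ : Vec (Fin (suc n)) (suc n)
      σ = adjoin π nothing

    fixed-orbit : ∀ j k → iter σ k (inject₁ j) ≡ inject₁ (iter π k j)
    fixed-orbit j zero    = refl
    fixed-orbit j (suc k) = trans (cong (lookup σ) (fixed-orbit j k)) (fixed-old π (iter π k j))

    cycleMin-fixed-old : ∀ j → isCycleMin σ (inject₁ j) ≡ isCycleMin π j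
    cycleMin-fixed-old j = isCycleMin-≡ (adjoin-injective inj nothing) inj
      (λ min k → inject₁-≤⁻ (subst (λ x → toℕ (inject₁ j) ≤ toℕ x) (fixed-orbit j k) (min k)))
      (λ min k → subst (λ x → toℕ (inject₁ j) ≤ toℕ x) (sym (fixed-orbit j k)) (inject₁-≤⁺ (min k)))

    cycleMin-fixed-new : isCycleMin σ (fromℕ n) ≡ true
    cycleMin-fixed-new = isCycleMin-true (adjoin-injective inj nothing) λ k → ℕP.≤-reflexive (cong toℕ (sym (fixed k)))
      where
      fixed : ∀ k → iter σ k (fromℕ n) ≡ fromℕ n
      fixed zero    = refl
      fixed (suc k) = trans (cong (lookup σ) (fixed k)) (fixed-new π)

  module _ (π : Vec (Fin n) n) (a j : Fin n) where

    private
      σ : Vec (Fin (suc n)) (suc n)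
      σ = adjoin π (just a)

    data OrbitPoint (x : Fin (suc n)) : Set where
      oldPoint : ∀ l → x ≡ inject₁ (iter π l j) → OrbitPoint x
      newAfter : ∀ l → iter π l j ≡ a → x ≡ fromℕ n → OrbitPoint x

    inserted-orbit-⊆ : ∀ k → OrbitPoint (iter σ k (inject₁ j))
    inserted-orbit-⊆ zero = oldPoint 0 refl
    inserted-orbit-⊆ (suc k) with inserted-orbit-⊆ k
    ... | newAfter l l↦a e = oldPoint (suc l) (begin
      lookup σ (iter σ k (inject₁ j)) ≡⟨ cong (lookup σ) e ⟩
      lookup σ (fromℕ n)              ≡⟨ inserted-new π a ⟩
      inject₁ (lookup π a)            ≡⟨ cong (inject₁ ∘ lookup π) (sym l↦a) ⟩
      inject₁ (iter π (suc l) j)      ∎)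
      where open ≡-Reasoning
    ... | oldPoint l e with iter π l j Fin.≟ a
    ...   | no l≢a   = oldPoint (suc l) (trans (cong (lookup σ) e) (inserted-old π a _ l≢a))
    ...   | yes l↦a = newAfter l l↦a
      (trans (cong (lookup σ) (trans e (cong inject₁ l↦a))) (inserted-after π a))

    inserted-orbit-⊇ : ∀ l → ∃ λ k → iter σ k (inject₁ j) ≡ inject₁ (iter π l j)
    inserted-orbit-⊇ zero = 0 , refl
    inserted-orbit-⊇ (suc l) with inserted-orbit-⊇ l | iter π l j Fin.≟ a
    ... | k , e | no l≢a   = suc k , trans (cong (lookup σ) e) (inserted-old π a _ l≢a)
    ... | k , e | yes l↦a = suc (suc k) , (begin
      lookup σ (lookup σ (iter σ k (inject₁ j))) ≡⟨ cong (lookup σ ∘ lookup σ) (trans e (cong inject₁ l↦a)) ⟩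
      lookup σ (lookup σ (inject₁ a))            ≡⟨ cong (lookup σ) (inserted-after π a) ⟩
      lookup σ (fromℕ n)                         ≡⟨ inserted-new π a ⟩
      inject₁ (lookup π a)                       ≡⟨ cong (inject₁ ∘ lookup π) (sym l↦a) ⟩
      inject₁ (iter π (suc l) j)                 ∎)
      where open ≡-Reasoning

  -- Old points keep their status; n is not a cycle minimum, being sent below itself.
  module _ (π : Vec (Fin n) n) (inj : Injective π) (a : Fin n) where

    private
      σ : Vec (Fin (suc n)) (suc n)
      σ = adjoin π (just a)

    cycleMin-inserted-old : ∀ j → isCycleMin σ (inject₁ j) ≡ isCycleMin π j
    cycleMin-inserted-old j = isCycleMin-≡ (adjoin-injective inj (just a)) inj
      (λ min l → let k , e = inserted-orbit-⊇ π a j l in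
        inject₁-≤⁻ (subst (λ x → toℕ (inject₁ j) ≤ toℕ x) e (min k)))
      (λ min k → bound min (inserted-orbit-⊆ π a j k))
      where
      bound : MinOfOrbit π j → ∀ {x} → OrbitPoint π a j x → toℕ (inject₁ j) ≤ toℕ x
      bound min (oldPoint l e)   = subst (λ x → toℕ (inject₁ j) ≤ toℕ x) (sym e) (inject₁-≤⁺ (min l))
      bound min (newAfter _ _ e) = subst (λ x → toℕ (inject₁ j) ≤ toℕ x) (sym e)
        (ℕP.<⇒≤ (subst (toℕ (inject₁ j) <_) (sym (FinP.toℕ-fromℕ n)) (FinP.inject₁ℕ< j)))

    cycleMin-inserted-new : isCycleMin σ (fromℕ n) ≡ false
    cycleMin-inserted-new = isCycleMin-false (adjoin-injective inj (just a)) λ min →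
      ℕP.<⇒≱ (subst₂ _<_ (sym (trans (cong toℕ (inserted-new π a)) (FinP.toℕ-inject₁ _))) (sym (FinP.toℕ-fromℕ n))
                         (FinP.toℕ<n (lookup π a)))
             (min 1)

  module _ {π : Vec (Fin n) n} (inj : Injective π) where

    cyc-fixed : cyc (adjoin π nothing) ≡ suc (cyc π)
    cyc-fixed = begin
      cyc (adjoin π nothing)
        ≡⟨ cyc-split (adjoin π nothing) ⟩
      #true (isCycleMin (adjoin π nothing) ∘ inject₁) + ⟦ isCycleMin (adjoin π nothing) (fromℕ n) ⟧
        ≡⟨ cong₂ _+_ (#true-cong (cycleMin-fixed-old π inj)) (cong ⟦_⟧ (cycleMin-fixed-new π inj)) ⟩
      #true (isCycleMin π) + 1
        ≡⟨ ℕP.+-comm _ 1 ⟩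
      suc (#true (isCycleMin π))
        ≡⟨ cong suc (sym (count≡#true (isCycleMin π))) ⟩
      suc (cyc π) ∎
      where open ≡-Reasoning

    cyc-inserted : (a : Fin n) → cyc (adjoin π (just a)) ≡ cyc π
    cyc-inserted a = begin
      cyc (adjoin π (just a))
        ≡⟨ cyc-split (adjoin π (just a)) ⟩
      #true (isCycleMin (adjoin π (just a)) ∘ inject₁) + ⟦ isCycleMin (adjoin π (just a)) (fromℕ n) ⟧
        ≡⟨ cong₂ _+_ (#true-cong (cycleMin-inserted-old π inj a)) (cong ⟦_⟧ (cycleMin-inserted-new π inj a)) ⟩
      #true (isCycleMin π) + 0
        ≡⟨ ℕP.+-identityʳ _ ⟩
      #true (isCycleMin π)
        ≡⟨ sym (count≡#true (isCycleMin π)) ⟩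
      cyc π ∎
      where open ≡-Reasoning

module Arithmetic where

  open import Data.Nat using (_+_)
  open import Data.Nat.Properties
  open import Relation.Binary.PropositionalEquality
  open ≡-Reasoning

  suc∸ : ∀ {k n} → k ≤ n → suc n ∸ k ≡ suc (n ∸ k)
  suc∸ = +-∸-assoc 1

  ∸-split : ∀ {n k j₁ j₂} → k ≤ n → j₁ ≤ k → j₂ ≤ n ∸ k → n ∸ (j₁ + j₂) ≡ (k ∸ j₁) + (n ∸ k ∸ j₂)
  ∸-split {n} {k} {j₁} {j₂} k≤n j₁≤k j₂≤m = begin
    n ∸ (j₁ + j₂)           ≡⟨ sym (∸-+-assoc n j₁ j₂) ⟩
    n ∸ j₁ ∸ j₂             ≡⟨ cong (λ t → t ∸ j₁ ∸ j₂) (sym (m+[n∸m]≡n k≤n)) ⟩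
    k + (n ∸ k) ∸ j₁ ∸ j₂   ≡⟨ cong (_∸ j₂) (+-∸-comm (n ∸ k) j₁≤k) ⟩
    (k ∸ j₁) + (n ∸ k) ∸ j₂ ≡⟨ +-∸-assoc (k ∸ j₁) j₂≤m ⟩
    (k ∸ j₁) + (n ∸ k ∸ j₂) ∎

module WeightedSums {c ℓ : Level} (R : CommutativeSemiring c ℓ) where

  open PermutationStatistics
  open Arithmetic
  open import Data.Nat as ℕ using (zero; _<_; z≤n; s≤s)
  import Data.Nat.Properties as ℕP
  open import Data.Nat.Combinatorics using (nCn≡1; nCk+nC[k+1]≡[n+1]C[k+1])
  open import Data.Fin using (Fin)
  open import Data.Vec using (Vec)
  open import Data.Maybe using (just)
  open import Data.Bool using (Bool; true; false; not)
  open import Data.List as List using (List; []; _∷_; _++_; allFin; tabulate; applyUpTo; cartesianProductWith)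
  import Data.List.Properties as ListP
  open import Data.List.Membership.Propositional using (_∈_)
  open import Data.List.Relation.Unary.Any using (here; there)
  open import Data.List.Relation.Binary.Permutation.Propositional using (_↭_; ↭⇒↭ₛ′)
  import Data.List.Relation.Binary.Permutation.Propositional.Properties as ↭
  import Data.List.Relation.Binary.Permutation.Setoid.Properties as ↭ₛ
  import Relation.Binary.PropositionalEquality as ≡
  open import Function using (_∘_)

  open CommutativeSemiring R
  open Eulerian R
  open import Relation.Binary.Reasoning.Setoid setoid
  import Algebra.Properties.Monoid.Mult +-monoid as Mult
  import Algebra.Properties.CommutativeMonoid.Mult +-commutativeMonoid as CommMult
  import Algebra.Properties.Semiring.Mult semiring as SemiringMult
  import Algebra.Properties.Semiring.Exp semiring as Exp
  import Algebra.Solver.CommutativeMonoid as CMSolver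
  open CMSolver +-commutativeMonoid using (solve; _⊕_; _⊜_)
  open CMSolver *-commutativeMonoid using () renaming (solve to solve*; _⊕_ to _⊗_; _⊜_ to _⊜*_)

  private variable
    n : ℕ
    S T U : Set

  ×-zeroʳ : ∀ r → r × 0# ≈ 0#
  ×-zeroʳ zero    = refl
  ×-zeroʳ (suc r) = trans (+-identityˡ _) (×-zeroʳ r)

  Σ-++ : (xs ys : List Carrier) → Σₗ (xs ++ ys) ≈ Σₗ xs + Σₗ ys
  Σ-++ []       ys = sym (+-identityˡ _)
  Σ-++ (x ∷ xs) ys = trans (+-congˡ (Σ-++ xs ys)) (sym (+-assoc _ _ _))

  Σ-cong : {f g : S → Carrier} (xs : List S) → (∀ x → x ∈ xs → f x ≈ g x) → Σₗ (map f xs) ≈ Σₗ (map g xs)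
  Σ-cong []       e = refl
  Σ-cong (x ∷ xs) e = +-cong (e x (here ≡.refl)) (Σ-cong xs λ y y∈ → e y (there y∈))

  Σ-+ : (f g : S → Carrier) (xs : List S) →
    Σₗ (map (λ x → f x + g x) xs) ≈ Σₗ (map f xs) + Σₗ (map g xs)
  Σ-+ f g []       = sym (+-identityˡ _)
  Σ-+ f g (x ∷ xs) = trans (+-congˡ (Σ-+ f g xs))
    (solve 4 (λ a b c d → (a ⊕ b) ⊕ (c ⊕ d) ⊜ (a ⊕ c) ⊕ (b ⊕ d)) refl (f x) (g x) _ _)

  Σ-× : (r : ℕ) (f : S → Carrier) (xs : List S) → Σₗ (map (λ x → r × f x) xs) ≈ r × Σₗ (map f xs)
  Σ-× r f []       = sym (×-zeroʳ r)
  Σ-× r f (x ∷ xs) = trans (+-congˡ (Σ-× r f xs)) (sym (CommMult.×-distrib-+ _ _ r))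

  Σ-* : (r : Carrier) (f : S → Carrier) (xs : List S) → Σₗ (map (λ x → r * f x) xs) ≈ r * Σₗ (map f xs)
  Σ-* r f []       = sym (zeroʳ r)
  Σ-* r f (x ∷ xs) = trans (+-congˡ (Σ-* r f xs)) (sym (distribˡ r _ _))

  Σ-↭ : (f : S → Carrier) {xs ys : List S} → xs ↭ ys → Σₗ (map f xs) ≈ Σₗ (map f ys)
  Σ-↭ f p = ↭ₛ.foldr-commMonoid setoid +-isCommutativeMonoid (↭⇒↭ₛ′ isEquivalence (↭.map⁺ f p))

  Σ-cartesianProduct : (g : U → Carrier) (f : S → T → U) (xs : List S) (ys : List T) →
    Σₗ (map g (cartesianProductWith f xs ys)) ≈ Σₗ (map (λ x → Σₗ (map (g ∘ f x) ys)) xs)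
  Σ-cartesianProduct g f []       ys = refl
  Σ-cartesianProduct g f (x ∷ xs) ys = begin
    Σₗ (map g (map (f x) ys ++ cartesianProductWith f xs ys))
      ≡⟨ ≡.cong Σₗ (ListP.map-++ g (map (f x) ys) _) ⟩
    Σₗ (map g (map (f x) ys) ++ map g (cartesianProductWith f xs ys))
      ≈⟨ Σ-++ (map g (map (f x) ys)) _ ⟩
    Σₗ (map g (map (f x) ys)) + Σₗ (map g (cartesianProductWith f xs ys))
      ≈⟨ +-cong (reflexive (≡.cong Σₗ (≡.sym (ListP.map-∘ ys)))) (Σ-cartesianProduct g f xs ys) ⟩
    Σₗ (map (g ∘ f x) ys) + Σₗ (map (λ x → Σₗ (map (g ∘ f x) ys)) xs) ∎

  Σ-indicator : (p : Fin n → Bool) (G : Bool → Carrier) →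
    Σₗ (tabulate (G ∘ p)) ≈ #true p × G true + (n ∸ #true p) × G false
  Σ-indicator {zero}  p G = sym (+-identityˡ _)
  Σ-indicator {suc n} p G with p Fin.zero | Σ-indicator (p ∘ Fin.suc) G
  ... | true  | ih = trans (+-congˡ ih) (sym (+-assoc _ _ _))
  ... | false | ih = begin
    G false + Σₗ (tabulate (G ∘ p ∘ Fin.suc))
      ≈⟨ +-congˡ ih ⟩
    G false + (#true (p ∘ Fin.suc) × G true + (n ∸ #true (p ∘ Fin.suc)) × G false)
      ≈⟨ solve 3 (λ a b d → a ⊕ (b ⊕ d) ⊜ b ⊕ (a ⊕ d)) refl (G false) _ _ ⟩
    #true (p ∘ Fin.suc) × G true + suc (n ∸ #true (p ∘ Fin.suc)) × G false
      ≡⟨ ≡.cong (λ t → #true (p ∘ Fin.suc) × G true + t × G false) (≡.sym (suc∸ (#true≤ (p ∘ Fin.suc)))) ⟩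
    #true (p ∘ Fin.suc) × G true + (suc n ∸ #true (p ∘ Fin.suc)) × G false ∎

  Weight : Set c
  Weight = ℕ → ℕ → Carrier

  permSum : ℕ → Weight → Carrier
  permSum n w = Σₗ (map (λ σ → w (exc σ) (cyc σ)) (perms n))

  -- Only the values w j c with j ≤ n matter, since a permutation of [n] has at most n excedances.
  permSum-cong : ∀ n {w w′ : Weight} → (∀ j c → j ≤ n → w j c ≈ w′ j c) → permSum n w ≈ permSum n w′
  permSum-cong n e = Σ-cong (perms n) (λ σ _ → e _ _ (exc≤ σ))

  permSum-+ : ∀ n (w w′ : Weight) → permSum n (λ j c → w j c + w′ j c) ≈ permSum n w + permSum n w′
  permSum-+ n w w′ = Σ-+ _ _ (perms n)

  permSum-× : ∀ n (r : ℕ) (w : Weight) → permSum n (λ j c → r × w j c) ≈ r × permSum n w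
  permSum-× n r w = Σ-× r _ (perms n)

  permSum-* : ∀ n (r : Carrier) (w : Weight) → permSum n (λ j c → r * w j c) ≈ r * permSum n w
  permSum-* n r w = Σ-* r _ (perms n)

  permSum-product : ∀ k m (u v : Weight) →
    permSum k (λ j₁ c₁ → permSum m (λ j₂ c₂ → u j₁ c₁ * v j₂ c₂)) ≈ permSum k u * permSum m v
  permSum-product k m u v = begin
    permSum k (λ j₁ c₁ → permSum m (λ j₂ c₂ → u j₁ c₁ * v j₂ c₂)) ≈⟨ permSum-cong k (λ j₁ c₁ _ → permSum-* m (u j₁ c₁) v) ⟩
    permSum k (λ j₁ c₁ → u j₁ c₁ * permSum m v)                     ≈⟨ permSum-cong k (λ j₁ c₁ _ → *-comm (u j₁ c₁) (permSum m v)) ⟩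
    permSum k (λ j₁ c₁ → permSum m v * u j₁ c₁)                     ≈⟨ permSum-* k (permSum m v) u ⟩
    permSum m v * permSum k u                                       ≈⟨ *-comm _ _ ⟩
    permSum k u * permSum m v                                       ∎

  -- The weight seen by π ∈ 𝔖_n when summing over the σ = adjoin π o ∈ 𝔖_{n+1}:
  -- one new cycle, or (n - exc π) ways to gain an excedance and exc π ways not to.
  stepWeight : ℕ → Weight → Weight
  stepWeight n w j c = w j (suc c) + (j × w j c + (n ∸ j) × w (suc j) c)

  adjoin-contribution : (w : Weight) {π : Vec (Fin n) n} → Injective π →
    Σₗ (map (λ o → w (exc (adjoin π o)) (cyc (adjoin π o))) (positions n)) ≈ stepWeight n w (exc π) (cyc π)
  adjoin-contribution {n} w {π} inj = +-cong
    (reflexive (≡.cong₂ w (exc-fixed π) (cyc-fixed inj)))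
    (begin
      Σₗ (map (λ o → w (exc (adjoin π o)) (cyc (adjoin π o))) (map just (allFin n)))
        ≡⟨ ≡.cong Σₗ (≡.trans (≡.sym (ListP.map-∘ (allFin n))) (ListP.map-tabulate (λ a → a) _)) ⟩
      Σₗ (tabulate (λ a → w (exc (adjoin π (just a))) (cyc (adjoin π (just a)))))
        ≡⟨ ≡.cong Σₗ (ListP.tabulate-cong λ a → ≡.cong₂ w (exc-inserted π a) (cyc-inserted inj a)) ⟩
      Σₗ (tabulate (G ∘ isExc π))
        ≈⟨ Σ-indicator (isExc π) G ⟩
      #true (isExc π) × G true + (n ∸ #true (isExc π)) × G false
        ≡⟨ ≡.cong (λ e → e × G true + (n ∸ e) × G false) (≡.sym (count≡#true (isExc π))) ⟩
      exc π × G true + (n ∸ exc π) × G false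
        ≡⟨ ≡.cong₂ (λ e₀ e₁ → exc π × w e₀ (cyc π) + (n ∸ exc π) × w e₁ (cyc π))
                   (ℕP.+-identityʳ (exc π)) (ℕP.+-comm (exc π) 1) ⟩
      exc π × w (exc π) (cyc π) + (n ∸ exc π) × w (suc (exc π)) (cyc π) ∎)
    where
    G : Bool → Carrier
    G b = w (exc π ℕ.+ ⟦ not b ⟧) (cyc π)

  permSum-suc : ∀ n (w : Weight) → permSum (suc n) w ≈ permSum n (stepWeight n w)
  permSum-suc n w = begin
    permSum (suc n) w
      ≈⟨ Σ-↭ weight (perms-suc↭ n) ⟩
    Σₗ (map weight (cartesianProductWith adjoin (perms n) (positions n)))
      ≈⟨ Σ-cartesianProduct weight adjoin (perms n) (positions n) ⟩
    Σₗ (map (λ π → Σₗ (map (weight ∘ adjoin π) (positions n))) (perms n))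
      ≈⟨ Σ-cong (perms n) (λ π π∈ → adjoin-contribution w (perms⁻ π∈)) ⟩
    permSum n (stepWeight n w) ∎
    where
    weight : Vec (Fin (suc n)) (suc n) → Carrier
    weight σ = w (exc σ) (cyc σ)

  Σ< : ℕ → (ℕ → Carrier) → Carrier
  Σ< n f = Σₗ (applyUpTo f n)

  Σ<-cong : ∀ n {f g : ℕ → Carrier} → (∀ k → k < n → f k ≈ g k) → Σ< n f ≈ Σ< n g
  Σ<-cong zero    e = refl
  Σ<-cong (suc n) e = +-cong (e 0 (s≤s z≤n)) (Σ<-cong n λ k k<n → e (suc k) (s≤s k<n))

  Σ<-+ : ∀ n (f g : ℕ → Carrier) → Σ< n (λ k → f k + g k) ≈ Σ< n f + Σ< n g
  Σ<-+ zero    f g = sym (+-identityˡ _)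
  Σ<-+ (suc n) f g = trans (+-congˡ (Σ<-+ n (f ∘ suc) (g ∘ suc)))
    (solve 4 (λ a b c d → (a ⊕ b) ⊕ (c ⊕ d) ⊜ (a ⊕ c) ⊕ (b ⊕ d)) refl (f 0) (g 0) _ _)

  Σ<-* : ∀ n (r : Carrier) (f : ℕ → Carrier) → Σ< n (λ k → r * f k) ≈ r * Σ< n f
  Σ<-* zero    r f = sym (zeroʳ r)
  Σ<-* (suc n) r f = trans (+-congˡ (Σ<-* n r (f ∘ suc))) (sym (distribˡ r _ _))

  Σ<-last : ∀ n (f : ℕ → Carrier) → Σ< (suc n) f ≈ Σ< n f + f n
  Σ<-last zero    f = trans (+-identityʳ _) (sym (+-identityˡ _))
  Σ<-last (suc n) f = trans (+-congˡ (Σ<-last n (f ∘ suc))) (sym (+-assoc _ _ _))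

  pascal : ∀ n (f : ℕ → Carrier) →
    Σ< n (λ k → (n C k) × (f (suc k) + f k)) + f n ≈ Σ< (suc n) (λ k → (suc n C k) × f k)
  pascal n f = begin
    Σ< n (λ k → (n C k) × (f (suc k) + f k)) + f n
      ≈⟨ +-congʳ (trans (Σ<-cong n (λ k _ → CommMult.×-distrib-+ _ _ (n C k))) (Σ<-+ n _ _)) ⟩
    (shifted + unshifted) + f n
      ≈⟨ +-assoc _ _ _ ⟩
    shifted + (unshifted + f n)
      ≈⟨ +-congˡ (+-congˡ (sym (trans (Mult.×-congˡ (nCn≡1 n)) (+-identityʳ _)))) ⟩
    shifted + (unshifted + (n C n) × f n)
      ≈⟨ +-congˡ (sym (Σ<-last n (λ k → (n C k) × f k))) ⟩
    shifted + ((n C 0) × f 0 + unshiftedTail)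
      ≈⟨ +-congˡ (+-congʳ (+-identityʳ _)) ⟩
    shifted + (f 0 + unshiftedTail)
      ≈⟨ solve 3 (λ a b d → a ⊕ (b ⊕ d) ⊜ b ⊕ (a ⊕ d)) refl shifted (f 0) unshiftedTail ⟩
    f 0 + (shifted + unshiftedTail)
      ≈⟨ +-congˡ (sym (Σ<-+ n _ _)) ⟩
    f 0 + Σ< n (λ k → (n C k) × f (suc k) + (n C suc k) × f (suc k))
      ≈⟨ +-congˡ (Σ<-cong n λ k _ → trans (sym (Mult.×-homo-+ _ (n C k) (n C suc k)))
                                          (Mult.×-congˡ (nCk+nC[k+1]≡[n+1]C[k+1] n k))) ⟩
    f 0 + Σ< n (λ k → (suc n C suc k) × f (suc k))
      ≈⟨ +-congʳ (sym (+-identityʳ _)) ⟩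
    Σ< (suc n) (λ k → (suc n C k) × f k) ∎
    where
    shifted unshifted unshiftedTail : Carrier
    shifted       = Σ< n (λ k → (n C k) × f (suc k))
    unshifted     = Σ< n (λ k → (n C k) × f k)
    unshiftedTail = Σ< n (λ k → (n C suc k) × f (suc k))

  shiftCyc : Weight → Weight
  shiftCyc w j c = w j (suc c)

  shiftBoth : Weight → Weight
  shiftBoth w j c = w (suc j) (suc c)

  pairWeight : Weight → ℕ → ℕ → Weight
  pairWeight w j₁ c₁ j₂ _ = w (suc (j₁ ℕ.+ j₂)) (suc c₁)

  convolution : ℕ → Weight → ℕ → Carrier
  convolution n w k = permSum k (λ j₁ c₁ → permSum (n ∸ k) (pairWeight w j₁ c₁))

  -- stepWeight is linear, so it commutes with an inner weighted sum.
  stepWeight-permSum : ∀ k m (W : ℕ → ℕ → Weight) j c →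
    stepWeight k (λ j′ c′ → permSum m (W j′ c′)) j c ≈ permSum m (λ j₂ c₂ → stepWeight k (λ j′ c′ → W j′ c′ j₂ c₂) j c)
  stepWeight-permSum k m W j c = sym (begin
    permSum m (λ j₂ c₂ → W j (suc c) j₂ c₂ + (j × W j c j₂ c₂ + (k ∸ j) × W (suc j) c j₂ c₂))
      ≈⟨ permSum-+ m (W j (suc c)) (λ j₂ c₂ → j × W j c j₂ c₂ + (k ∸ j) × W (suc j) c j₂ c₂) ⟩
    permSum m (W j (suc c)) + permSum m (λ j₂ c₂ → j × W j c j₂ c₂ + (k ∸ j) × W (suc j) c j₂ c₂)
      ≈⟨ +-congˡ (permSum-+ m (λ j₂ c₂ → j × W j c j₂ c₂) (λ j₂ c₂ → (k ∸ j) × W (suc j) c j₂ c₂)) ⟩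
    permSum m (W j (suc c)) + (permSum m (λ j₂ c₂ → j × W j c j₂ c₂) + permSum m (λ j₂ c₂ → (k ∸ j) × W (suc j) c j₂ c₂))
      ≈⟨ +-congˡ (+-cong (permSum-× m j (W j c)) (permSum-× m (k ∸ j) (W (suc j) c))) ⟩
    permSum m (W j (suc c)) + (j × permSum m (W j c) + (k ∸ j) × permSum m (W (suc j) c)) ∎)

  -- Pointwise heart of the induction: the n - (j₁ + j₂) ways of gaining an
  -- excedance split between the two factors of a pair.
  stepWeight-split : ∀ {n k j₁ j₂} → k ≤ n → j₁ ≤ k → j₂ ≤ n ∸ k → (w : Weight) (c₁ c₂ : ℕ) →
    stepWeight (suc n) w (suc (j₁ ℕ.+ j₂)) (suc c₁) ≈
      stepWeight k (λ j c → pairWeight w j c j₂ c₂) j₁ c₁ + stepWeight (n ∸ k) (pairWeight w j₁ c₁) j₂ c₂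
  stepWeight-split {n} {k} {j₁} {j₂} k≤n j₁≤k j₂≤m w c₁ c₂ = begin
    a + (suc (j₁ ℕ.+ j₂) × b + (n ∸ (j₁ ℕ.+ j₂)) × d)
      ≈⟨ +-congˡ (+-cong (+-congˡ (Mult.×-homo-+ b j₁ j₂))
                         (trans (Mult.×-congˡ (∸-split k≤n j₁≤k j₂≤m)) (Mult.×-homo-+ d (k ∸ j₁) (n ∸ k ∸ j₂)))) ⟩
    a + ((b + (j₁ × b + j₂ × b)) + ((k ∸ j₁) × d + (n ∸ k ∸ j₂) × d))
      ≈⟨ solve 6 (λ a b x₁ x₂ y₁ y₂ → a ⊕ ((b ⊕ (x₁ ⊕ x₂)) ⊕ (y₁ ⊕ y₂)) ⊜ (a ⊕ (x₁ ⊕ y₁)) ⊕ (b ⊕ (x₂ ⊕ y₂)))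
               refl a b (j₁ × b) (j₂ × b) ((k ∸ j₁) × d) ((n ∸ k ∸ j₂) × d) ⟩
    (a + (j₁ × b + (k ∸ j₁) × d)) + (b + (j₂ × b + (n ∸ k ∸ j₂) × d))
      ≡⟨ ≡.cong (λ t → (a + (j₁ × b + (k ∸ j₁) × d)) + (b + (j₂ × b + (n ∸ k ∸ j₂) × w (suc t) (suc c₁))))
                (≡.sym (ℕP.+-suc j₁ j₂)) ⟩
    stepWeight k (λ j c → pairWeight w j c j₂ c₂) j₁ c₁ + stepWeight (n ∸ k) (pairWeight w j₁ c₁) j₂ c₂ ∎
    where
    a b d : Carrier
    a = w (suc (j₁ ℕ.+ j₂)) (suc (suc c₁))
    b = w (suc (j₁ ℕ.+ j₂)) (suc c₁)
    d = w (suc (suc (j₁ ℕ.+ j₂))) (suc c₁)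

  shiftCyc-step : ∀ n (w : Weight) →
    permSum n (shiftCyc (stepWeight (suc n) w)) ≈ permSum (suc n) (shiftCyc w) + permSum n (shiftBoth w)
  shiftCyc-step n w = begin
    permSum n (shiftCyc (stepWeight (suc n) w))                    ≈⟨ permSum-cong n split ⟩
    permSum n (λ j c → stepWeight n (shiftCyc w) j c + shiftBoth w j c) ≈⟨ permSum-+ n (stepWeight n (shiftCyc w)) (shiftBoth w) ⟩
    permSum n (stepWeight n (shiftCyc w)) + permSum n (shiftBoth w) ≈⟨ +-congʳ (sym (permSum-suc n (shiftCyc w))) ⟩
    permSum (suc n) (shiftCyc w) + permSum n (shiftBoth w)          ∎
    where
    split : ∀ j c → j ≤ n → shiftCyc (stepWeight (suc n) w) j c ≈ stepWeight n (shiftCyc w) j c + shiftBoth w j c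
    split j c j≤n = trans (+-congˡ (+-congˡ (reflexive (≡.cong (_× shiftBoth w j c) (suc∸ j≤n)))))
      (solve 4 (λ a b d e → a ⊕ (b ⊕ (d ⊕ e)) ⊜ (a ⊕ (b ⊕ e)) ⊕ d) refl _ _ _ _)

  convolution-step : ∀ n (w : Weight) k → k < n →
    convolution n (stepWeight (suc n) w) k ≈ convolution (suc n) w (suc k) + convolution (suc n) w k
  convolution-step n w k k<n = begin
    convolution n (stepWeight (suc n) w) k
      ≈⟨ permSum-cong k (λ j₁ c₁ j₁≤k → permSum-cong m λ j₂ c₂ j₂≤m →
           stepWeight-split (ℕP.<⇒≤ k<n) j₁≤k j₂≤m w c₁ c₂) ⟩
    permSum k (λ j₁ c₁ → permSum m (λ j₂ c₂ → first j₁ c₁ j₂ c₂ + second j₁ c₁ j₂ c₂))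
      ≈⟨ permSum-cong k (λ j₁ c₁ _ → permSum-+ m (first j₁ c₁) (second j₁ c₁)) ⟩
    permSum k (λ j₁ c₁ → permSum m (first j₁ c₁) + permSum m (second j₁ c₁))
      ≈⟨ permSum-+ k (λ j₁ c₁ → permSum m (first j₁ c₁)) (λ j₁ c₁ → permSum m (second j₁ c₁)) ⟩
    permSum k (λ j₁ c₁ → permSum m (first j₁ c₁)) + permSum k (λ j₁ c₁ → permSum m (second j₁ c₁))
      ≈⟨ +-cong (permSum-cong k λ j₁ c₁ _ → sym (stepWeight-permSum k m (pairWeight w) j₁ c₁))
                (permSum-cong k λ j₁ c₁ _ → sym (permSum-suc m (pairWeight w j₁ c₁))) ⟩
    permSum k (stepWeight k (λ j₁ c₁ → permSum m (pairWeight w j₁ c₁))) + permSum k (λ j₁ c₁ → permSum (suc m) (pairWeight w j₁ c₁))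
      ≈⟨ +-cong (sym (permSum-suc k (λ j₁ c₁ → permSum m (pairWeight w j₁ c₁))))
                (reflexive (≡.cong (λ t → permSum k (λ j₁ c₁ → permSum t (pairWeight w j₁ c₁))) (≡.sym (suc∸ (ℕP.<⇒≤ k<n))))) ⟩
    convolution (suc n) w (suc k) + convolution (suc n) w k ∎
    where
    m : ℕ
    m = n ∸ k
    first second : ℕ → ℕ → Weight
    first  j₁ c₁ j₂ c₂ = stepWeight k (λ j c → pairWeight w j c j₂ c₂) j₁ c₁
    second j₁ c₁ j₂ c₂ = stepWeight m (pairWeight w j₁ c₁) j₂ c₂

  -- The last term: the second factor lies in 𝔖_1, a single fixed point.
  convolution-last : ∀ n (w : Weight) → convolution (suc n) w n ≈ permSum n (shiftBoth w)
  convolution-last n w = begin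
    convolution (suc n) w n
      ≡⟨ ≡.cong (λ t → permSum n (λ j₁ c₁ → permSum t (pairWeight w j₁ c₁))) (≡.trans (suc∸ (ℕP.≤-refl {n})) (≡.cong suc (ℕP.n∸n≡0 n))) ⟩
    permSum n (λ j₁ c₁ → permSum 1 (pairWeight w j₁ c₁))
      ≈⟨ permSum-cong n (λ j₁ c₁ _ → trans (+-identityʳ _) (reflexive (≡.cong (λ t → w (suc t) (suc c₁)) (ℕP.+-identityʳ j₁)))) ⟩
    permSum n (shiftBoth w) ∎

  binomial-identity : ∀ n (w : Weight) →
    permSum (suc n) w ≈ permSum n (shiftCyc w) + Σ< n (λ k → (n C k) × convolution n w k)
  binomial-identity zero    w = sym (+-identityʳ _)
  binomial-identity (suc n) w = begin
    permSum (suc (suc n)) w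
      ≈⟨ permSum-suc (suc n) w ⟩
    permSum (suc n) (stepWeight (suc n) w)
      ≈⟨ binomial-identity n (stepWeight (suc n) w) ⟩
    permSum n (shiftCyc (stepWeight (suc n) w)) + Σ< n (λ k → (n C k) × convolution n (stepWeight (suc n) w) k)
      ≈⟨ +-cong (shiftCyc-step n w) (Σ<-cong n λ k k<n → Mult.×-congʳ (n C k) (convolution-step n w k k<n)) ⟩
    (permSum (suc n) (shiftCyc w) + permSum n (shiftBoth w)) + Σ< n (λ k → (n C k) × (Z (suc k) + Z k))
      ≈⟨ solve 3 (λ a b d → (a ⊕ b) ⊕ d ⊜ a ⊕ (d ⊕ b)) refl _ (permSum n (shiftBoth w)) _ ⟩
    permSum (suc n) (shiftCyc w) + (Σ< n (λ k → (n C k) × (Z (suc k) + Z k)) + permSum n (shiftBoth w))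
      ≈⟨ +-congˡ (+-congˡ (sym (convolution-last n w))) ⟩
    permSum (suc n) (shiftCyc w) + (Σ< n (λ k → (n C k) × (Z (suc k) + Z k)) + Z n)
      ≈⟨ +-congˡ (pascal n Z) ⟩
    permSum (suc n) (shiftCyc w) + Σ< (suc n) (λ k → (suc n C k) × Z k) ∎
    where
    Z : ℕ → Carrier
    Z = convolution (suc n) w

  module _ (x q : Carrier) where

    monomial : Weight
    monomial j c = x ^ j * q ^ c

    shiftCyc-monomial : ∀ n → permSum n (shiftCyc monomial) ≈ q * Aq n x q
    shiftCyc-monomial n = trans
      (permSum-cong n λ j c _ → solve* 3 (λ X Q Qc → X ⊗ (Q ⊗ Qc) ⊜* Q ⊗ (X ⊗ Qc)) refl (x ^ j) q (q ^ c))
      (permSum-* n q monomial)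

    convolution-monomial : ∀ n k → convolution n monomial k ≈ (q * x) * (Aq k x q * A (n ∸ k) x)
    convolution-monomial n k = begin
      convolution n monomial k
        ≈⟨ permSum-cong k (λ j₁ c₁ _ → permSum-cong (n ∸ k) λ j₂ _ _ → factor j₁ c₁ j₂) ⟩
      permSum k (λ j₁ c₁ → permSum (n ∸ k) (λ j₂ _ → ((q * x) * monomial j₁ c₁) * x ^ j₂))
        ≈⟨ permSum-product k (n ∸ k) (λ j₁ c₁ → (q * x) * monomial j₁ c₁) (λ j₂ _ → x ^ j₂) ⟩
      permSum k (λ j₁ c₁ → (q * x) * monomial j₁ c₁) * A (n ∸ k) x
        ≈⟨ *-congʳ (permSum-* k (q * x) monomial) ⟩
      ((q * x) * Aq k x q) * A (n ∸ k) x
        ≈⟨ *-assoc _ _ _ ⟩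
      (q * x) * (Aq k x q * A (n ∸ k) x) ∎
      where
      factor : ∀ j₁ c₁ j₂ → x ^ suc (j₁ ℕ.+ j₂) * q ^ suc c₁ ≈ ((q * x) * (x ^ j₁ * q ^ c₁)) * x ^ j₂
      factor j₁ c₁ j₂ = trans (*-congʳ (*-congˡ (Exp.^-homo-* x j₁ j₂)))
        (solve* 5 (λ X X₁ X₂ Q Qc → (X ⊗ (X₁ ⊗ X₂)) ⊗ (Q ⊗ Qc) ⊜* ((Q ⊗ X) ⊗ (X₁ ⊗ Qc)) ⊗ X₂)
                refl x (x ^ j₁) (x ^ j₂) q (q ^ c₁))

    binomialSum-monomial : ∀ n → Σ< n (λ k → (n C k) × convolution n monomial k) ≈
      (q * x) * Σₗ (map (λ k → (n C k) × (Aq k x q * A (n ∸ k) x)) (upTo n))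
    binomialSum-monomial n = begin
      Σ< n (λ k → (n C k) × convolution n monomial k)
        ≈⟨ Σ<-cong n (λ k _ → trans (Mult.×-congʳ (n C k) (convolution-monomial n k))
                                    (sym (SemiringMult.×-comm-* (n C k) (q * x) _))) ⟩
      Σ< n (λ k → (q * x) * ((n C k) × (Aq k x q * A (n ∸ k) x)))
        ≈⟨ Σ<-* n (q * x) _ ⟩
      (q * x) * Σ< n (λ k → (n C k) × (Aq k x q * A (n ∸ k) x))
        ≡⟨ ≡.cong (λ t → (q * x) * Σₗ t) (≡.sym (ListP.map-upTo _ n)) ⟩
      (q * x) * Σₗ (map (λ k → (n C k) × (Aq k x q * A (n ∸ k) x)) (upTo n)) ∎

-- The identity also holds
-- for n = 0.
mainTheorem2 : ∀ {c ℓ : Level} (R : CommutativeSemiring c ℓ) →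
    let open CommutativeSemiring R
        open Eulerian R
    in ∀ (n : ℕ) → 1 ≤ n → ∀ (x q : Carrier) →
       Aq (suc n) x q ≈
         (q * Aq n x q)
         + ((q * x) * Σₗ (map (λ k → (n C k) × (Aq k x q * A (n ∸ k) x)) (upTo n)))
mainTheorem2 R n _ x q = begin
  Aq (suc n) x q
    ≈⟨ binomial-identity n (monomial x q) ⟩
  permSum n (shiftCyc (monomial x q)) + Σ< n (λ k → (n C k) × convolution n (monomial x q) k)
    ≈⟨ +-cong (shiftCyc-monomial x q n) (binomialSum-monomial x q n) ⟩
  q * Aq n x q + (q * x) * Σₗ (map (λ k → (n C k) × (Aq k x q * A (n ∸ k) x)) (upTo n)) ∎
  where
  open CommutativeSemiring R
  open Eulerian R
  open WeightedSums R
  open import Relation.Binary.Reasoning.Setoid setoid
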